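{- Let $b\geq 2$ and $k\in\mathbb{Z}^+$. If a $k$-mirage base $b$ contains only positive integers, then it is a $k$-oasis base $b$.
   Context: For integers $c\geq 0$ and $b\geq 2$, the augmented generalized happy function $S_{[c,b]}:\mathbb{Z}^+\to\mathbb{Z}^+$ is defined by $S_{[c,b]}\left(\sum_{i=0}^n a_i b^i\right)=c+\sum_{i=0}^n a_i^2$, where $0\le a_i\le b-1$, $a_n\neq 0$ (the base $b$ expansion); additionally $S_{[0,b]}(0)=0$. A positive integer $a$ is a fixed point of $S_{[c,b]}$ if $S_{[c,b]}(a)=a$. A $k$-oasis base $b$ is a set of $k$ consecutive non-negative integers $c$ such that for each of them $S_{[c,b]}$ has at least one fixed point. A $k$-mirage base $b$ is a set of $k$ consecutive integers $\{d_1,\dots,d_k\}$ such that for each $1\le i\le k$, $d_i=r_i-S_{[0,b]}(r_i)$ for some non-negative integer $r_i$ having at most three base $b$ digits (i.e., $0\le r_i<b^3$). -}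

module Defs where

open import Data.Nat using (ℕ; zero; suc; _+_; _*_; _^_; _<_; NonZero)
open import Data.Nat.DivMod using (_/_; _%_)
open import Data.Integer as ℤ using (ℤ; +_)
open import Data.Product using (Σ; _×_)
open import Relation.Binary.PropositionalEquality using (_≡_)

-- Sum of squares of the base-b digits of n, processing at most 'fuel' digits.
-- Leading zero digits contribute 0, so any fuel ≥ number of digits gives the same value.
digitSqSumAux : (b : ℕ) → .{{NonZero b}} → ℕ → ℕ → ℕ
digitSqSumAux b zero      n = 0
digitSqSumAux b (suc fuel) n = (n % b) ^ 2 + digitSqSumAux b fuel (n / b)

-- For b ≥ 2, n has at most n digits (n ≥ 1), so fuel n suffices; gives 0 at n = 0.
digitSqSum : (b : ℕ) → .{{NonZero b}} → ℕ → ℕ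
digitSqSum b n = digitSqSumAux b n n

S : (c b : ℕ) → .{{NonZero b}} → ℕ → ℕ
S c b n = c + digitSqSum b n

IsFixedPoint : (c b : ℕ) → .{{NonZero b}} → ℕ → Set
IsFixedPoint c b a = (0 < a) × (S c b a ≡ a)

IsOasis : (b : ℕ) → .{{NonZero b}} → (k c₀ : ℕ) → Set
IsOasis b k c₀ = (i : ℕ) → i < k → Σ ℕ (λ a → IsFixedPoint (c₀ + i) b a)

IsMirage : (b : ℕ) → .{{NonZero b}} → (k : ℕ) → (d : ℤ) → Set
IsMirage b k d = (i : ℕ) → i < k →
  Σ ℕ (λ r → (r < b ^ 3) × (d ℤ.+ + i ≡ + r ℤ.- + S 0 b r))

{-# OPTIONS --safe #-}
-- If d + i = r − S_[0,b](r) with d + i > 0, then r = (d + i) + S_[0,b](r) = S_[d+i,b](r)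
-- and r ≥ d + i > 0, so r itself is a fixed point of S_[d+i,b].
module Submission where

open import Defs
open import Data.Nat using (ℕ; _+_; _≤_; _<_; NonZero)
open import Data.Nat.Properties using (≤-trans; m≤m+n)
open import Data.Integer as ℤ using (ℤ; +_; ∣_∣; +<+)
open import Data.Integer.Properties using (+-assoc; +-inverseˡ; +-identityʳ; +-injective; <⇒≤; 0≤i⇒+∣i∣≡i)
open import Data.Product using (Σ; _×_; _,_)
open import Relation.Binary.PropositionalEquality using (_≡_; sym; trans; cong; subst; module ≡-Reasoning)

i≡j-k⇒j≡i+k : ∀ {i j k : ℤ} → i ≡ j ℤ.- k → j ≡ i ℤ.+ k
i≡j-k⇒j≡i+k {i} {j} {k} i≡j-k = sym (begin
  i ℤ.+ k               ≡⟨ cong (ℤ._+ k) i≡j-k ⟩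
  (j ℤ.- k) ℤ.+ k       ≡⟨ +-assoc j (ℤ.- k) k ⟩
  j ℤ.+ (ℤ.- k ℤ.+ k)   ≡⟨ cong (λ x → j ℤ.+ x) (+-inverseˡ k) ⟩
  j ℤ.+ + 0             ≡⟨ +-identityʳ j ⟩
  j                     ∎)
  where open ≡-Reasoning

mirage-witness⇒fixedPoint : (b : ℕ) → .{{_ : NonZero b}} → (c r : ℕ) → 0 < c →
                            + c ≡ + r ℤ.- + S 0 b r → IsFixedPoint c b r
mirage-witness⇒fixedPoint b c r 0<c c≡r-Sr = 0<r , sym r≡Scr
  where
  r≡Scr : r ≡ S c b r
  r≡Scr = +-injective (i≡j-k⇒j≡i+k {k = + S 0 b r} c≡r-Sr)

  0<r : 0 < r
  0<r = subst (0 <_) (sym r≡Scr) (≤-trans 0<c (m≤m+n c (digitSqSum b r)))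

lemma9 : (b : ℕ) → .{{_ : NonZero b}} → 2 ≤ b → (k : ℕ) → 0 < k → (d : ℤ) →
    IsMirage b k d →
    ((i : ℕ) → i < k → ℤ.+ 0 ℤ.< d ℤ.+ + i) →
    Σ ℕ (λ c₀ → (+ c₀ ≡ d) × IsOasis b k c₀)
lemma9 b _ k 0<k d mirage positive = ∣ d ∣ , ∣d∣≡d , oasis
  where
  ∣d∣≡d : + ∣ d ∣ ≡ d
  ∣d∣≡d = 0≤i⇒+∣i∣≡i (subst (ℤ.+ 0 ℤ.≤_) (+-identityʳ d) (<⇒≤ (positive 0 0<k)))

  ∣d∣+i≡d+i : ∀ i → + (∣ d ∣ + i) ≡ d ℤ.+ + i
  ∣d∣+i≡d+i i = cong (ℤ._+ + i) ∣d∣≡d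

  oasis : IsOasis b k ∣ d ∣
  oasis i i<k with mirage i i<k
  ... | r , _ , d+i≡r-Sr = r , mirage-witness⇒fixedPoint b (∣ d ∣ + i) r 0<∣d∣+i
                                 (trans (∣d∣+i≡d+i i) d+i≡r-Sr)
    where
    0<∣d∣+i : 0 < ∣ d ∣ + i
    0<∣d∣+i with subst (ℤ.+ 0 ℤ.<_) (sym (∣d∣+i≡d+i i)) (positive i i<k)
    ... | +<+ 0<∣d∣+i = 0<∣d∣+i
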